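{- For every integer $n\geq 2$ and every integer $\ell$ with $8\leq \ell\leq 2^n n!$, the burnt pancake graph $BP_n$ contains a cycle of length $\ell$. In particular, $BP_n$ has a Hamiltonian cycle.
   Context: A signed permutation of $[\pm n]=\{ -n,\dots,-1,1,\dots,n\}$ is a bijection $w$ of $[\pm n]$ with $w(-i)=-w(i)$; it is written in window notation $w=[w(1)\,w(2)\,\cdots\,w(n)]$, and $\underline{i}$ denotes $-i$. The group of signed permutations is $B_n$, with $|B_n|=2^n n!$. For $1\leq i\leq n$, the prefix reversal $r_i$ acts on $w$ by $w r_i=[\underline{w(i)}\,\underline{w(i-1)}\cdots\underline{w(1)}\,w(i+1)\cdots w(n)]$ (reverse the first $i$ entries and change their signs). The burnt pancake graph $BP_n$ is the graph with vertex set $B_n$ and an edge between $w$ and $w r_i$ for every $w\in B_n$ and $1\leq i\leq n$ (the Cayley graph of $B_n$ with respect to the prefix reversals). -}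

module Defs where

open import Data.Bool using (Bool; true; false; not)
open import Data.Nat using (ℕ; _≤_)
open import Data.Fin using (Fin)
open import Data.List using (List; []; _∷_; _++_; map; reverse; take; drop; length; allFin; _∷ʳ_)
open import Data.Product using (_×_; _,_; proj₁; proj₂; ∃-syntax)
open import Data.List.Relation.Unary.All using (All)
open import Data.List.Relation.Unary.Unique.Propositional using (Unique)
open import Data.List.Relation.Unary.Linked using (Linked)
open import Data.List.Relation.Binary.Permutation.Propositional using (_↭_)
open import Relation.Binary.PropositionalEquality using (_≡_)

-- A signed entry: (s , a) stands for the value -(a+1) if s ≡ true and (a+1) if s ≡ false.
-- (The absolute value a+1 ∈ {1..n} is encoded by a : Fin n.)
SEntry : ℕ → Set
SEntry n = Bool × Fin n

neg : ∀ {n} → SEntry n → SEntry n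
neg (s , a) = (not s , a)

Window : ℕ → Set
Window n = List (SEntry n)

-- The window describes a signed permutation of [±n]: it has n entries and
-- the absolute values form a permutation of {1,...,n}.
IsSignedPerm : (n : ℕ) → Window n → Set
IsSignedPerm n w = map proj₂ w ↭ allFin n

prefixRev : ∀ {n} → ℕ → Window n → Window n
prefixRev k w = map neg (reverse (take k w)) ++ drop k w

BPAdj : (n : ℕ) → Window n → Window n → Set
BPAdj n w w' = ∃[ k ] (1 ≤ k × k ≤ n × w' ≡ prefixRev k w)

HasCycleOfLength : (n ℓ : ℕ) → Set
HasCycleOfLength n ℓ =
  ∃[ v ] ∃[ rest ]
    ( length (v ∷ rest) ≡ ℓ
    × All (IsSignedPerm n) (v ∷ rest)
    × Unique (v ∷ rest)
    × Linked (BPAdj n) ((v ∷ rest) ∷ʳ v) )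

-- Write N_n = 2ⁿn! = |B_n| and call a path of
-- BP_n from the identity e to e·r_n with m distinct vertices a good path of order m;
-- since r_n is an involution, closing it with the edge r_n gives a cycle of length m.
-- Inside BP_{n+1}, the windows with a fixed bottom entry form 2n+2 disjoint copies of
-- BP_n (the embedded copy fixing n+1, relabelled by the powers of `lower`), and the
-- edge r_{n+1} leads from the end of a good path in one copy to the start of the next.
-- Chaining good paths of orders m₀, …, m_{2n+1}, one in each copy, therefore yields a
-- good path of BP_{n+1} of order m₀ + ⋯ + m_{2n+1}.  If BP_n has good paths of order 2
-- and of every order in [A, N_n], every order in [A + 2(2n+1), N_{n+1}] is such a sum;
-- shorter cycles of BP_{n+1} are cycles of the embedded BP_n.  The induction starts at
-- n = 3 from a table of good paths of orders 8, …, 48 checked by evaluation, and BP_2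
-- is itself an 8-cycle.
module Submission where

open import Defs
open import Data.Nat using (ℕ; _≤_; _*_; _^_; _!)

open import Data.Nat as ℕ using (zero; suc; _+_; _∸_; _<_; z≤n; s≤s)
import Data.Nat.Properties as ℕP
open import Data.Bool using (true; false; not)
import Data.Bool.Properties as BoolP
open import Data.Fin as Fin using (toℕ; fromℕ; inject₁)
import Data.Fin.Properties as FinP
open import Data.List using (List; []; _∷_; _++_; map; reverse; take; drop; length; allFin; tabulate; _∷ʳ_; head; upTo)
open import Data.Nat.ListAction using (sum)
import Data.List.Properties as ListP
open import Data.Product using (_×_; _,_; proj₁; proj₂; Σ)
open import Data.Sum using (_⊎_; inj₁; inj₂)
open import Data.Empty using (⊥-elim)
open import Data.Unit using (tt)
open import Data.List.Relation.Unary.All as All using (All; []; _∷_)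
open import Data.List.Relation.Unary.AllPairs using ([]; _∷_)
open import Data.List.Relation.Unary.Unique.Propositional using (Unique)
import Data.List.Relation.Unary.Unique.Propositional.Properties as UniqueP
open import Data.List.Relation.Unary.Linked using (Linked; [-]; _∷_)
open import Data.List.Relation.Binary.Permutation.Propositional using (_↭_; ↭-reflexive; ↭-trans; module PermutationReasoning)
import Data.List.Relation.Binary.Permutation.Propositional.Properties as PermP
open import Data.List.Membership.Propositional using (_∈_)
import Data.List.Membership.Propositional.Properties as MemP
import Data.List.Relation.Unary.All.Properties as AllP
open import Data.Nat.GeneralisedArithmetic using (iterate)
open import Data.Nat.Tactic.RingSolver using (solve-∀)
open import Relation.Binary.PropositionalEquality
open import Relation.Nullary using (¬_; yes; no; Dec)
import Relation.Nullary.Decidable as Decidable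
open import Relation.Nullary.Decidable using (toWitness; _×-dec_)
open import Relation.Binary.Definitions using (DecidableEquality)
import Data.Product.Properties as ProdP
import Data.List.Relation.Unary.Unique.DecPropositional as UniqueD
open import Data.Maybe using (fromMaybe)
open import Function using (_∘_)

turn : ∀ {n} → Window n → Window n
turn p = map neg (reverse p)

neg-involutive : ∀ {n} (x : SEntry n) → neg (neg x) ≡ x
neg-involutive (s , a) = cong (_, a) (BoolP.not-involutive s)

map-neg-involutive : ∀ {n} (l : Window n) → map neg (map neg l) ≡ l
map-neg-involutive l = trans (sym (ListP.map-∘ l)) (trans (ListP.map-cong neg-involutive l) (ListP.map-id l))

turn-involutive : ∀ {n} (p : Window n) → turn (turn p) ≡ p
turn-involutive p = begin
  map neg (reverse (map neg (reverse p)))  ≡⟨ cong (map neg) (sym (ListP.reverse-map neg (reverse p))) ⟩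
  map neg (map neg (reverse (reverse p)))  ≡⟨ map-neg-involutive _ ⟩
  reverse (reverse p)                      ≡⟨ ListP.reverse-involutive p ⟩
  p                                        ∎
  where open ≡-Reasoning

length-turn : ∀ {n} (p : Window n) → length (turn p) ≡ length p
length-turn p = trans (ListP.length-map neg (reverse p)) (ListP.length-reverse p)

turn-∷ʳ : ∀ {n} (p : Window n) x → turn (p ∷ʳ x) ≡ neg x ∷ turn p
turn-∷ʳ p x = cong (map neg) (ListP.reverse-++ p (x ∷ []))

turn-∷ : ∀ {n} x (p : Window n) → turn (x ∷ p) ≡ turn p ∷ʳ neg x
turn-∷ x p = trans (cong (map neg) (ListP.unfold-reverse x p)) (ListP.map-++ neg (reverse p) (x ∷ []))

SignRespecting : ∀ {n m} → (SEntry n → SEntry m) → Set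
SignRespecting f = ∀ x → f (neg x) ≡ neg (f x)

turn-relabel : ∀ {n m} (f : SEntry n → SEntry m) → SignRespecting f →
               ∀ p → turn (map f p) ≡ map f (turn p)
turn-relabel f f-sign p = begin
  map neg (reverse (map f p))   ≡⟨ cong (map neg) (sym (ListP.reverse-map f p)) ⟩
  map neg (map f (reverse p))   ≡⟨ sym (ListP.map-∘ (reverse p)) ⟩
  map (λ x → neg (f x)) (reverse p) ≡⟨ ListP.map-cong (λ x → sym (f-sign x)) (reverse p) ⟩
  map (λ x → f (neg x)) (reverse p) ≡⟨ ListP.map-∘ (reverse p) ⟩
  map f (turn p)                ∎
  where open ≡-Reasoning

take-prefix : ∀ {A : Set} (p d : List A) → take (length p) (p ++ d) ≡ p
take-prefix []      d = refl
take-prefix (x ∷ p) d = cong (x ∷_) (take-prefix p d)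

drop-prefix : ∀ {A : Set} (p d : List A) → drop (length p) (p ++ d) ≡ d
drop-prefix []      d = refl
drop-prefix (x ∷ p) d = drop-prefix p d

length-take≤ : ∀ {A : Set} k (l : List A) → k ≤ length l → length (take k l) ≡ k
length-take≤ k l k≤ = trans (ListP.length-take k l) (ℕP.m≤n⇒m⊓n≡m k≤)

prefixRev-split : ∀ {n} k (p d : Window n) → length p ≡ k → prefixRev k (p ++ d) ≡ turn p ++ d
prefixRev-split _ p d refl = cong₂ (λ t b → turn t ++ b) (take-prefix p d) (drop-prefix p d)

prefixRev-whole : ∀ {n} k (w : Window n) → length w ≡ k → prefixRev k w ≡ turn w
prefixRev-whole k w len = begin
  prefixRev k w         ≡⟨ cong (prefixRev k) (sym (ListP.++-identityʳ w)) ⟩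
  prefixRev k (w ++ []) ≡⟨ prefixRev-split k w [] len ⟩
  turn w ++ []          ≡⟨ ListP.++-identityʳ (turn w) ⟩
  turn w                ∎
  where open ≡-Reasoning

prefixRev-++ : ∀ {n} k (l m : Window n) → k ≤ length l → prefixRev k (l ++ m) ≡ prefixRev k l ++ m
prefixRev-++ k l m k≤ = begin
  prefixRev k (l ++ m)             ≡⟨ cong (λ z → prefixRev k (z ++ m)) (sym (ListP.take++drop≡id k l)) ⟩
  prefixRev k ((top ++ rest) ++ m) ≡⟨ cong (prefixRev k) (ListP.++-assoc top rest m) ⟩
  prefixRev k (top ++ (rest ++ m)) ≡⟨ prefixRev-split k top (rest ++ m) (length-take≤ k l k≤) ⟩
  turn top ++ (rest ++ m)          ≡⟨ sym (ListP.++-assoc (turn top) rest m) ⟩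
  prefixRev k l ++ m               ∎
  where
  open ≡-Reasoning
  top = take k l
  rest = drop k l

prefixRev-involutive : ∀ {n} k (w : Window n) → k ≤ length w → prefixRev k (prefixRev k w) ≡ w
prefixRev-involutive k w k≤ = begin
  prefixRev k (turn top ++ rest) ≡⟨ prefixRev-split k (turn top) rest (trans (length-turn top) (length-take≤ k w k≤)) ⟩
  turn (turn top) ++ rest        ≡⟨ cong (_++ rest) (turn-involutive top) ⟩
  top ++ rest                    ≡⟨ ListP.take++drop≡id k w ⟩
  w                              ∎
  where
  open ≡-Reasoning
  top = take k w
  rest = drop k w

length-prefixRev : ∀ {n} k (w : Window n) → length (prefixRev k w) ≡ length w
length-prefixRev k w = begin
  length (turn top ++ rest)          ≡⟨ ListP.length-++ (turn top) ⟩
  length (turn top) + length rest    ≡⟨ cong (_+ length rest) (length-turn top) ⟩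
  length top + length rest           ≡⟨ sym (ListP.length-++ top) ⟩
  length (top ++ rest)               ≡⟨ cong length (ListP.take++drop≡id k w) ⟩
  length w                           ∎
  where
  open ≡-Reasoning
  top = take k w
  rest = drop k w

prefixRev-relabel : ∀ {n m} (f : SEntry n → SEntry m) → SignRespecting f →
                    ∀ k w → prefixRev k (map f w) ≡ map f (prefixRev k w)
prefixRev-relabel f f-sign k w = begin
  turn (take k (map f w)) ++ drop k (map f w)
    ≡⟨ cong₂ (λ t b → turn t ++ b) (ListP.take-map k w) (ListP.drop-map k w) ⟩
  turn (map f (take k w)) ++ map f (drop k w)
    ≡⟨ cong (_++ map f (drop k w)) (turn-relabel f f-sign (take k w)) ⟩
  map f (turn (take k w)) ++ map f (drop k w)
    ≡⟨ sym (ListP.map-++ f (turn (take k w)) (drop k w)) ⟩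
  map f (prefixRev k w) ∎
  where open ≡-Reasoning

prefixRev-signed : ∀ {n} k (w : Window n) → IsSignedPerm n w → IsSignedPerm n (prefixRev k w)
prefixRev-signed k w w-perm = ↭-trans rearranged w-perm
  where
  top = take k w
  rest = drop k w
  values-turn : map proj₂ (turn top) ≡ reverse (map proj₂ top)
  values-turn = trans (sym (ListP.map-∘ (reverse top))) (ListP.reverse-map proj₂ top)
  rearranged : map proj₂ (prefixRev k w) ↭ map proj₂ w
  rearranged = begin
    map proj₂ (turn top ++ rest)              ≡⟨ ListP.map-++ proj₂ (turn top) rest ⟩
    map proj₂ (turn top) ++ map proj₂ rest    ≡⟨ cong (_++ map proj₂ rest) values-turn ⟩
    reverse (map proj₂ top) ++ map proj₂ rest ↭⟨ PermP.++⁺ʳ (map proj₂ rest) (PermP.↭-reverse (map proj₂ top)) ⟩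
    map proj₂ top ++ map proj₂ rest           ≡⟨ sym (ListP.map-++ proj₂ top rest) ⟩
    map proj₂ (top ++ rest)                   ≡⟨ cong (map proj₂) (ListP.take++drop≡id k w) ⟩
    map proj₂ w                               ∎
    where open PermutationReasoning

steps : ∀ {n} → Window n → List ℕ → List (Window n)
steps v []       = []
steps v (k ∷ ks) = prefixRev k v ∷ steps (prefixRev k v) ks

walk : ∀ {n} → Window n → List ℕ → List (Window n)
walk v ks = v ∷ steps v ks

walkEnd : ∀ {n} → Window n → List ℕ → Window n
walkEnd v []       = v
walkEnd v (k ∷ ks) = walkEnd (prefixRev k v) ks

Indices : ℕ → List ℕ → Set
Indices n ks = All (λ k → 1 ≤ k × k ≤ n) ks

length-walk : ∀ {n} (v : Window n) ks → length (walk v ks) ≡ suc (length ks)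
length-walk v []       = refl
length-walk v (k ∷ ks) = cong suc (length-walk (prefixRev k v) ks)

length-walkEnd : ∀ {n} (v : Window n) ks → length (walkEnd v ks) ≡ length v
length-walkEnd v []       = refl
length-walkEnd v (k ∷ ks) = trans (length-walkEnd (prefixRev k v) ks) (length-prefixRev k v)

walk-relabel : ∀ {n m} (f : SEntry n → SEntry m) → SignRespecting f →
               ∀ ks v → walk (map f v) ks ≡ map (map f) (walk v ks)
walk-relabel f f-sign []       v = refl
walk-relabel f f-sign (k ∷ ks) v =
  cong (map f v ∷_) (trans (cong (λ z → walk z ks) (prefixRev-relabel f f-sign k v))
                           (walk-relabel f f-sign ks (prefixRev k v)))

walkEnd-relabel : ∀ {n m} (f : SEntry n → SEntry m) → SignRespecting f →
                  ∀ ks v → walkEnd (map f v) ks ≡ map f (walkEnd v ks)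
walkEnd-relabel f f-sign []       v = refl
walkEnd-relabel f f-sign (k ∷ ks) v =
  trans (cong (λ z → walkEnd z ks) (prefixRev-relabel f f-sign k v))
        (walkEnd-relabel f f-sign ks (prefixRev k v))

walk-++ : ∀ {n} (v : Window n) ks k ks′ →
          walk v (ks ++ k ∷ ks′) ≡ walk v ks ++ walk (prefixRev k (walkEnd v ks)) ks′
walk-++ v []       k ks′ = refl
walk-++ v (j ∷ ks) k ks′ = cong (v ∷_) (walk-++ (prefixRev j v) ks k ks′)

walkEnd-++ : ∀ {n} (v : Window n) ks ks′ → walkEnd v (ks ++ ks′) ≡ walkEnd (walkEnd v ks) ks′
walkEnd-++ v []       ks′ = refl
walkEnd-++ v (j ∷ ks) ks′ = walkEnd-++ (prefixRev j v) ks ks′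

walk-linked : ∀ {n} (v : Window n) ks w → Indices n ks → BPAdj n (walkEnd v ks) w →
              Linked (BPAdj n) (walk v ks ∷ʳ w)
walk-linked v []       w []                 adj = adj ∷ [-]
walk-linked v (k ∷ ks) w ((1≤k , k≤n) ∷ ok) adj =
  (k , 1≤k , k≤n , refl) ∷ walk-linked (prefixRev k v) ks w ok adj

walk-signed : ∀ {n} (v : Window n) ks → IsSignedPerm n v → All (IsSignedPerm n) (walk v ks)
walk-signed v []       v-perm = v-perm ∷ []
walk-signed v (k ∷ ks) v-perm = v-perm ∷ walk-signed (prefixRev k v) ks (prefixRev-signed k v v-perm)

-- BP_n inside BP_{n+1}: the signed permutations of [±(n+1)] fixing n+1, obtained by
-- appending the entry n+1 at the bottom of the stack.
embedEntry : ∀ {n} → SEntry n → SEntry (suc n)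
embedEntry (s , a) = (s , inject₁ a)

largest : ∀ n → SEntry (suc n)
largest n = (false , fromℕ n)

embed : ∀ {n} → Window n → Window (suc n)
embed {n} v = map embedEntry v ∷ʳ largest n

embedEntry-sign : ∀ {n} → SignRespecting (embedEntry {n})
embedEntry-sign (s , a) = refl

embedEntry-injective : ∀ {n} {x y : SEntry n} → embedEntry x ≡ embedEntry y → x ≡ y
embedEntry-injective eq = cong₂ _,_ (cong proj₁ eq) (FinP.inject₁-injective (cong proj₂ eq))

embed-injective : ∀ {n} {v w : Window n} → embed v ≡ embed w → v ≡ w
embed-injective {v = v} {w} eq =
  ListP.map-injective embedEntry-injective (ListP.∷ʳ-injectiveˡ (map embedEntry v) (map embedEntry w) eq)

prefixRev-embed : ∀ {n} k (v : Window n) → k ≤ length v → prefixRev k (embed v) ≡ embed (prefixRev k v)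
prefixRev-embed {n} k v k≤ =
  trans (prefixRev-++ k (map embedEntry v) (largest n ∷ []) (subst (k ≤_) (sym (ListP.length-map embedEntry v)) k≤))
        (cong (_∷ʳ largest n) (prefixRev-relabel embedEntry embedEntry-sign k v))

walk-embed : ∀ {n} ks (v : Window n) → length v ≡ n → Indices n ks → walk (embed v) ks ≡ map embed (walk v ks)
walk-embed []       v len ok = refl
walk-embed (k ∷ ks) v len ((_ , k≤n) ∷ ok) =
  cong (embed v ∷_) (trans (cong (λ z → walk z ks) (prefixRev-embed k v (subst (k ≤_) (sym len) k≤n)))
                           (walk-embed ks (prefixRev k v) (trans (length-prefixRev k v) len) ok))

walkEnd-embed : ∀ {n} ks (v : Window n) → length v ≡ n → Indices n ks → walkEnd (embed v) ks ≡ embed (walkEnd v ks)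
walkEnd-embed []       v len ok = refl
walkEnd-embed (k ∷ ks) v len ((_ , k≤n) ∷ ok) =
  trans (cong (λ z → walkEnd z ks) (prefixRev-embed k v (subst (k ≤_) (sym len) k≤n)))
        (walkEnd-embed ks (prefixRev k v) (trans (length-prefixRev k v) len) ok)

indices-weaken : ∀ {n} ks → Indices n ks → Indices (suc n) ks
indices-weaken ks = All.map (λ (1≤k , k≤n) → 1≤k , ℕP.m≤n⇒m≤1+n k≤n)

shiftEntry : ∀ {n} → SEntry n → SEntry (suc n)
shiftEntry (s , a) = (s , Fin.suc a)

identity : (n : ℕ) → Window n
identity zero    = []
identity (suc n) = (false , Fin.zero) ∷ map shiftEntry (identity n)

flipped : (n : ℕ) → Window n
flipped n = prefixRev n (identity n)

length-identity : ∀ n → length (identity n) ≡ n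
length-identity zero    = refl
length-identity (suc n) = cong suc (trans (ListP.length-map shiftEntry (identity n)) (length-identity n))

length-flipped : ∀ n → length (flipped n) ≡ n
length-flipped n = trans (length-prefixRev n (identity n)) (length-identity n)

identity-signed : ∀ n → IsSignedPerm n (identity n)
identity-signed n = ↭-reflexive (values n)
  where
  values : ∀ n → map proj₂ (identity n) ≡ allFin n
  values zero    = refl
  values (suc n) = cong (Fin.zero ∷_) (begin
    map proj₂ (map shiftEntry (identity n)) ≡⟨ sym (ListP.map-∘ (identity n)) ⟩
    map (Fin.suc ∘ proj₂) (identity n)      ≡⟨ ListP.map-∘ (identity n) ⟩
    map Fin.suc (map proj₂ (identity n))    ≡⟨ cong (map Fin.suc) (values n) ⟩
    map Fin.suc (allFin n)                  ≡⟨ ListP.map-tabulate (λ i → i) Fin.suc ⟩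
    tabulate Fin.suc                        ∎)
    where open ≡-Reasoning

identity-embed : ∀ n → identity (suc n) ≡ embed (identity n)
identity-embed zero    = refl
identity-embed (suc n) = cong ((false , Fin.zero) ∷_) (begin
  map shiftEntry (identity (suc n))                             ≡⟨ cong (map shiftEntry) (identity-embed n) ⟩
  map shiftEntry (map embedEntry (identity n) ∷ʳ largest n)     ≡⟨ ListP.map-++ shiftEntry (map embedEntry (identity n)) _ ⟩
  map shiftEntry (map embedEntry (identity n)) ∷ʳ largest (suc n) ≡⟨ cong (_∷ʳ largest (suc n)) (shift-embed (identity n)) ⟩
  map embedEntry (map shiftEntry (identity n)) ∷ʳ largest (suc n) ∎)
  where
  open ≡-Reasoning
  shift-embed : ∀ (l : Window n) → map shiftEntry (map embedEntry l) ≡ map embedEntry (map shiftEntry l)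
  shift-embed l = trans (sym (ListP.map-∘ l)) (ListP.map-∘ l)

flipped-turn : ∀ n → flipped n ≡ turn (identity n)
flipped-turn n = prefixRev-whole n (identity n) (length-identity n)

unflip : ∀ n → prefixRev n (flipped n) ≡ identity n
unflip n = prefixRev-involutive n (identity n) (ℕP.≤-reflexive (sym (length-identity n)))

length-embed : ∀ {n} (v : Window n) → length v ≡ n → length (embed v) ≡ suc n
length-embed v len = begin
  length (map embedEntry v ++ _)   ≡⟨ ListP.length-++ (map embedEntry v) ⟩
  length (map embedEntry v) + 1    ≡⟨ ℕP.+-comm _ 1 ⟩
  suc (length (map embedEntry v))  ≡⟨ cong suc (trans (ListP.length-map embedEntry v) len) ⟩
  suc _                            ∎
  where open ≡-Reasoning

iterate-+ : ∀ {A : Set} (f : A → A) x a b → iterate f x (a + b) ≡ iterate f (iterate f x a) b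
iterate-+ f x zero    b = refl
iterate-+ f x (suc a) b = iterate-+ f (f x) a b

iterate-pull : ∀ {A : Set} (f : A → A) x j → iterate f (f x) j ≡ f (iterate f x j)
iterate-pull f x zero    = refl
iterate-pull f x (suc j) = iterate-pull f (f x) j

iterate-agree : ∀ {A : Set} (f g : A → A) → (∀ y → f (g y) ≡ g (f y)) →
                ∀ x → f x ≡ g x → ∀ j → iterate f x j ≡ iterate g x j
iterate-agree f g comm x fx≡gx zero    = refl
iterate-agree f g comm x fx≡gx (suc j) =
  trans (cong (λ z → iterate f z j) fx≡gx)
        (iterate-agree f g comm (g x) (trans (comm x) (cong g fx≡gx)) j)

-- The relabelling i ↦ i-1 (for 2 ≤ i ≤ n+1) and 1 ↦ -(n+1) of the values in [±(n+1)].
-- Its powers send the bottom entry n+1 to n, n-1, …, 1, -(n+1), …, -1 in turn, so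
-- relabelling the embedded BP_n by them gives 2n+2 disjoint copies of BP_n in BP_{n+1}.
lower : ∀ {n} → SEntry (suc n) → SEntry (suc n)
lower {n} (s , Fin.zero)  = (not s , fromℕ n)
lower     (s , Fin.suc a) = (s , inject₁ a)

lower-sign : ∀ {n} → SignRespecting (lower {n})
lower-sign (s , Fin.zero)  = refl
lower-sign (s , Fin.suc a) = refl

lower-injective : ∀ {n} {x y : SEntry (suc n)} → lower x ≡ lower y → x ≡ y
lower-injective {x = s , Fin.zero}  {t , Fin.zero}  eq = cong (_, Fin.zero) (BoolP.not-injective (cong proj₁ eq))
lower-injective {x = s , Fin.zero}  {t , Fin.suc b} eq = ⊥-elim (FinP.fromℕ≢inject₁ (cong proj₂ eq))
lower-injective {x = s , Fin.suc a} {t , Fin.zero}  eq = ⊥-elim (FinP.fromℕ≢inject₁ (sym (cong proj₂ eq)))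
lower-injective {x = s , Fin.suc a} {t , Fin.suc b} eq =
  cong₂ _,_ (cong proj₁ eq) (cong Fin.suc (FinP.inject₁-injective (cong proj₂ eq)))

flip-inside : ∀ n → prefixRev n (identity (suc n)) ≡ embed (flipped n)
flip-inside n = trans (cong (prefixRev n) (identity-embed n))
                      (prefixRev-embed n (identity n) (ℕP.≤-reflexive (sym (length-identity n))))

bridge : ∀ n → prefixRev (suc n) (embed (flipped n)) ≡ map lower (identity (suc n))
bridge n = begin
  prefixRev (suc n) (embed (flipped n))
    ≡⟨ prefixRev-whole (suc n) (embed (flipped n)) (length-embed (flipped n) (length-flipped n)) ⟩
  turn (map embedEntry (flipped n) ∷ʳ largest n)
    ≡⟨ turn-∷ʳ (map embedEntry (flipped n)) (largest n) ⟩
  negLargest ∷ turn (map embedEntry (flipped n))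
    ≡⟨ cong (negLargest ∷_) (turn-relabel embedEntry embedEntry-sign (flipped n)) ⟩
  negLargest ∷ map embedEntry (turn (flipped n))
    ≡⟨ cong (λ z → negLargest ∷ map embedEntry z) flipped-back ⟩
  negLargest ∷ map embedEntry (identity n)
    ≡⟨ cong (negLargest ∷_) (sym (lower-shift (identity n))) ⟩
  map lower (identity (suc n))
    ∎
  where
  open ≡-Reasoning
  negLargest = neg (largest n)
  flipped-back : turn (flipped n) ≡ identity n
  flipped-back = trans (cong turn (flipped-turn n)) (turn-involutive (identity n))
  lower-shift : ∀ (l : Window n) → map lower (map shiftEntry l) ≡ map embedEntry l
  lower-shift l = trans (sym (ListP.map-∘ l)) (ListP.map-cong (λ _ → refl) l)

-- The rotation w ↦ w r_{n+1} r_n of BP_{n+1}: it moves the top entry to the bottom,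
-- negated.  Hence n+1 rotations negate a window and 2n+2 rotations are the identity.
rotate : ∀ {n} → Window (suc n) → Window (suc n)
rotate {n} w = prefixRev n (prefixRev (suc n) w)

rotate-∷ : ∀ {n} x (l : Window (suc n)) → length l ≡ n → rotate {n} (x ∷ l) ≡ l ∷ʳ neg x
rotate-∷ {n} x l len = begin
  prefixRev n (prefixRev (suc n) (x ∷ l)) ≡⟨ cong (prefixRev n) (prefixRev-whole (suc n) (x ∷ l) (cong suc len)) ⟩
  prefixRev n (turn (x ∷ l))              ≡⟨ cong (prefixRev n) (turn-∷ x l) ⟩
  prefixRev n (turn l ∷ʳ neg x)           ≡⟨ prefixRev-split n (turn l) (neg x ∷ []) (trans (length-turn l) len) ⟩
  turn (turn l) ∷ʳ neg x                  ≡⟨ cong (_∷ʳ neg x) (turn-involutive l) ⟩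
  l ∷ʳ neg x                              ∎
  where open ≡-Reasoning

rotate-iterate : ∀ {n} (p q : Window (suc n)) → length (p ++ q) ≡ suc n →
                 iterate (rotate {n}) (p ++ q) (length p) ≡ q ++ map neg p
rotate-iterate     []      q len = sym (ListP.++-identityʳ q)
rotate-iterate {n} (x ∷ p) q len = begin
  iterate rotate (rotate (x ∷ (p ++ q))) (length p) ≡⟨ cong (λ z → iterate rotate z (length p)) (rotate-∷ x (p ++ q) (ℕP.suc-injective len)) ⟩
  iterate rotate ((p ++ q) ∷ʳ neg x) (length p)     ≡⟨ cong (λ z → iterate rotate z (length p)) (ListP.++-assoc p q (neg x ∷ [])) ⟩
  iterate rotate (p ++ (q ∷ʳ neg x)) (length p)     ≡⟨ rotate-iterate p (q ∷ʳ neg x) len′ ⟩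
  (q ∷ʳ neg x) ++ map neg p                         ≡⟨ ListP.++-assoc q (neg x ∷ []) (map neg p) ⟩
  q ++ map neg (x ∷ p)                              ∎
  where
  open ≡-Reasoning
  len′ : length (p ++ (q ∷ʳ neg x)) ≡ suc n
  len′ = trans (cong length (sym (ListP.++-assoc p q (neg x ∷ []))))
               (trans (ListP.length-++ (p ++ q)) (trans (ℕP.+-comm (length (p ++ q)) 1) len))

rotate-half-period : ∀ {n} (w : Window (suc n)) → length w ≡ suc n → iterate (rotate {n}) w (suc n) ≡ map neg w
rotate-half-period {n} w len = begin
  iterate rotate w (suc n)             ≡⟨ cong (iterate rotate w) (sym len) ⟩
  iterate rotate w (length w)          ≡⟨ cong (λ z → iterate rotate z (length w)) (sym (ListP.++-identityʳ w)) ⟩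
  iterate rotate (w ++ []) (length w)  ≡⟨ rotate-iterate w [] (trans (cong length (ListP.++-identityʳ w)) len) ⟩
  map neg w                            ∎
  where open ≡-Reasoning

rotate-period : ∀ {n} (w : Window (suc n)) → length w ≡ suc n → iterate (rotate {n}) w (suc n + suc n) ≡ w
rotate-period {n} w len = begin
  iterate rotate w (suc n + suc n)              ≡⟨ iterate-+ rotate w (suc n) (suc n) ⟩
  iterate rotate (iterate rotate w (suc n)) (suc n) ≡⟨ cong (λ z → iterate rotate z (suc n)) (rotate-half-period w len) ⟩
  iterate rotate (map neg w) (suc n)            ≡⟨ rotate-half-period (map neg w) (trans (ListP.length-map neg w) len) ⟩
  map neg (map neg w)                           ≡⟨ map-neg-involutive w ⟩
  w                                             ∎
  where open ≡-Reasoning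

rotate-relabel : ∀ {n} (f : SEntry (suc n) → SEntry (suc n)) → SignRespecting f →
                 ∀ w → rotate {n} (map f w) ≡ map f (rotate w)
rotate-relabel {n} f f-sign w =
  trans (cong (prefixRev n) (prefixRev-relabel f f-sign (suc n) w))
        (prefixRev-relabel f f-sign n (prefixRev (suc n) w))

-- Following the 2n+2 relabelled copies, the end of the last copy is the vertex
-- flipped (n+1): on the end of the first copy, relabelling acts as the rotation,
-- whose period is 2n+2.
last-copy-end : ∀ n → iterate (map lower) (embed (flipped n)) (suc (n + n)) ≡ flipped (suc n)
last-copy-end n = begin
  iterate (map lower) start (suc (n + n))
    ≡⟨ sym (iterate-agree rotate (map lower) (rotate-relabel lower lower-sign) start rotate-start (suc (n + n))) ⟩
  iterate rotate start (suc (n + n))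
    ≡⟨ cong (λ z → iterate rotate z (suc (n + n))) (sym start-rotated) ⟩
  iterate rotate (rotate end) (suc (n + n))
    ≡⟨ cong (iterate rotate end) (cong suc (sym (ℕP.+-suc n n))) ⟩
  iterate rotate end (suc n + suc n)
    ≡⟨ rotate-period end (length-flipped (suc n)) ⟩
  end
    ∎
  where
  open ≡-Reasoning
  start = embed (flipped n)
  end = flipped (suc n)
  rotate-start : rotate start ≡ map lower start
  rotate-start = begin
    prefixRev n (prefixRev (suc n) start)  ≡⟨ cong (prefixRev n) (bridge n) ⟩
    prefixRev n (map lower (identity (suc n))) ≡⟨ prefixRev-relabel lower lower-sign n (identity (suc n)) ⟩
    map lower (prefixRev n (identity (suc n))) ≡⟨ cong (map lower) (flip-inside n) ⟩
    map lower start                        ∎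
  start-rotated : rotate end ≡ start
  start-rotated = trans (cong (prefixRev n) (unflip (suc n))) (flip-inside n)

-- rank x = j when x = lower^j (n+1); it distinguishes the bottom entries of the copies.
rank : ∀ {n} → SEntry (suc n) → ℕ
rank {n} (false , a) = n ∸ toℕ a
rank {n} (true  , a) = suc (n + (n ∸ toℕ a))

rank-largest : ∀ n → rank (largest n) ≡ 0
rank-largest n = trans (cong (n ∸_) (FinP.toℕ-fromℕ n)) (ℕP.n∸n≡0 n)

rank-lower : ∀ {n} (x : SEntry (suc n)) → rank x < suc (n + n) → rank (lower x) ≡ suc (rank x)
rank-lower {n} (false , Fin.zero)  _ =
  cong suc (trans (cong (λ z → n + (n ∸ z)) (FinP.toℕ-fromℕ n)) (trans (cong (n +_) (ℕP.n∸n≡0 n)) (ℕP.+-identityʳ n)))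
rank-lower {n} (false , Fin.suc a) _ = trans (cong (n ∸_) (FinP.toℕ-inject₁ a)) (ℕP.+-∸-assoc 1 (FinP.toℕ<n a))
rank-lower {n} (true , Fin.zero)  r< = ⊥-elim (ℕP.<-irrefl refl r<)
rank-lower {n} (true , Fin.suc a) _ =
  cong suc (trans (cong (λ z → n + (n ∸ z)) (FinP.toℕ-inject₁ a))
                  (trans (cong (n +_) (ℕP.+-∸-assoc 1 (FinP.toℕ<n a))) (ℕP.+-suc n _)))

record GoodWord (n : ℕ) (W : List ℕ) : Set where
  field
    valid    : Indices n W
    distinct : Unique (walk (identity n) W)
    ends     : walkEnd (identity n) W ≡ flipped n

good-walk-embed : ∀ n W → GoodWord n W → walk (identity (suc n)) W ≡ map embed (walk (identity n) W)
good-walk-embed n W g =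
  trans (cong (λ z → walk z W) (identity-embed n)) (walk-embed W (identity n) (length-identity n) (GoodWord.valid g))

good-end-embed : ∀ n W → GoodWord n W → walkEnd (identity (suc n)) W ≡ embed (flipped n)
good-end-embed n W g =
  trans (cong (λ z → walkEnd z W) (identity-embed n))
        (trans (walkEnd-embed W (identity n) (length-identity n) (GoodWord.valid g)) (cong embed (GoodWord.ends g)))

-- Chaining words W₀, W₁, …, W_k of BP_n by the edges r_{n+1}: in BP_{n+1}, the j-th
-- word runs in the j-th copy of BP_n (relabelled by lower^j).
chain : ℕ → List ℕ → List (List ℕ) → List ℕ
chain n W []        = W
chain n W (W′ ∷ Ws) = W ++ suc n ∷ chain n W′ Ws

chainOrder : List (List ℕ) → ℕ
chainOrder []       = 0
chainOrder (W ∷ Ws) = suc (length W) + chainOrder Ws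

length-chain-walk : ∀ n W Ws → length (walk (identity (suc n)) (chain n W Ws)) ≡ chainOrder (W ∷ Ws)
length-chain-walk n W Ws = trans (length-walk (identity (suc n)) (chain n W Ws)) (cong suc (length-chain W Ws))
  where
  length-chain : ∀ W Ws → length (chain n W Ws) ≡ length W + chainOrder Ws
  length-chain W []        = sym (ℕP.+-identityʳ (length W))
  length-chain W (W′ ∷ Ws) = trans (ListP.length-++ W) (cong (λ z → length W + suc z) (length-chain W′ Ws))

chain-valid : ∀ n W Ws → All (GoodWord n) (W ∷ Ws) → Indices (suc n) (chain n W Ws)
chain-valid n W []        (g ∷ _)  = indices-weaken W (GoodWord.valid g)
chain-valid n W (W′ ∷ Ws) (g ∷ gs) =
  AllP.++⁺ (indices-weaken W (GoodWord.valid g)) ((s≤s z≤n , ℕP.≤-refl) ∷ chain-valid n W′ Ws gs)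

chain-walk : ∀ n W W′ Ws → GoodWord n W →
  walk (identity (suc n)) (chain n W (W′ ∷ Ws))
    ≡ map embed (walk (identity n) W) ++ map (map lower) (walk (identity (suc n)) (chain n W′ Ws))
chain-walk n W W′ Ws g = begin
  walk e′ (W ++ suc n ∷ rest)
    ≡⟨ walk-++ e′ W (suc n) rest ⟩
  walk e′ W ++ walk (prefixRev (suc n) (walkEnd e′ W)) rest
    ≡⟨ cong₂ (λ a b → a ++ walk (prefixRev (suc n) b) rest) (good-walk-embed n W g) (good-end-embed n W g) ⟩
  first ++ walk (prefixRev (suc n) (embed (flipped n))) rest
    ≡⟨ cong (λ z → first ++ walk z rest) (bridge n) ⟩
  first ++ walk (map lower e′) rest
    ≡⟨ cong (first ++_) (walk-relabel lower lower-sign rest e′) ⟩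
  first ++ map (map lower) (walk e′ rest)
    ∎
  where
  open ≡-Reasoning
  e′ = identity (suc n)
  rest = chain n W′ Ws
  first = map embed (walk (identity n) W)

chain-end : ∀ n W Ws → All (GoodWord n) (W ∷ Ws) →
            walkEnd (identity (suc n)) (chain n W Ws) ≡ iterate (map lower) (embed (flipped n)) (length Ws)
chain-end n W []        (g ∷ _)  = good-end-embed n W g
chain-end n W (W′ ∷ Ws) (g ∷ gs) = begin
  walkEnd e′ (W ++ suc n ∷ rest)                            ≡⟨ walkEnd-++ e′ W (suc n ∷ rest) ⟩
  walkEnd (prefixRev (suc n) (walkEnd e′ W)) rest           ≡⟨ cong (λ z → walkEnd (prefixRev (suc n) z) rest) (good-end-embed n W g) ⟩
  walkEnd (prefixRev (suc n) (embed (flipped n))) rest      ≡⟨ cong (λ z → walkEnd z rest) (bridge n) ⟩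
  walkEnd (map lower e′) rest                               ≡⟨ walkEnd-relabel lower lower-sign rest e′ ⟩
  map lower (walkEnd e′ rest)                               ≡⟨ cong (map lower) (chain-end n W′ Ws gs) ⟩
  map lower (iterate (map lower) (embed (flipped n)) (length Ws)) ≡⟨ sym (iterate-pull (map lower) (embed (flipped n)) (length Ws)) ⟩
  iterate (map lower) (map lower (embed (flipped n))) (length Ws) ∎
  where
  open ≡-Reasoning
  e′ = identity (suc n)
  rest = chain n W′ Ws

-- The bottom entry of v has rank below j: v lies in one of the first j copies.
BottomBelow : ∀ n → ℕ → Window (suc n) → Set
BottomBelow n j v = Σ (Window (suc n)) λ l → Σ (SEntry (suc n)) λ x → v ≡ l ∷ʳ x × rank x < j

embedded-bottom : ∀ {n} j (u : Window n) → BottomBelow n (suc j) (embed u)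
embedded-bottom {n} j u = map embedEntry u , largest n , refl , subst (_< suc j) (sym (rank-largest n)) (s≤s z≤n)

lowered-bottom : ∀ {n j v} → j ≤ suc (n + n) → BottomBelow n j v → BottomBelow n (suc j) (map lower v)
lowered-bottom {j = j} j≤ (l , x , refl , x<) =
  map lower l , lower x , ListP.map-++ lower l (x ∷ []) ,
  subst (_< suc j) (sym (rank-lower x (ℕP.≤-trans x< j≤))) (s≤s x<)

embedded≢lowered : ∀ {n j} (u : Window n) v → j ≤ suc (n + n) → BottomBelow n j v → embed u ≢ map lower v
embedded≢lowered {n} u _ j≤ (l , x , refl , x<) eq = ℕP.0≢1+n (begin
  0                ≡⟨ sym (rank-largest n) ⟩
  rank (largest n) ≡⟨ cong rank (ListP.∷ʳ-injectiveʳ (map embedEntry u) (map lower l) (trans eq (ListP.map-++ lower l (x ∷ [])))) ⟩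
  rank (lower x)   ≡⟨ rank-lower x (ℕP.≤-trans x< j≤) ⟩
  suc (rank x)     ∎)
  where open ≡-Reasoning

chain-bottoms : ∀ n W Ws → All (GoodWord n) (W ∷ Ws) → length Ws ≤ suc (n + n) →
                ∀ {v} → v ∈ walk (identity (suc n)) (chain n W Ws) → BottomBelow n (suc (length Ws)) v
chain-bottoms n W [] (g ∷ _) _ v∈ rewrite good-walk-embed n W g with MemP.∈-map⁻ embed v∈
... | u , _ , refl = embedded-bottom 0 u
chain-bottoms n W (W′ ∷ Ws) (g ∷ gs) (s≤s len) v∈ rewrite chain-walk n W W′ Ws g
  with MemP.∈-++⁻ (map embed (walk (identity n) W)) v∈
... | inj₁ v∈first with MemP.∈-map⁻ embed v∈first
...   | u , _ , refl = embedded-bottom (suc (length Ws)) u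
chain-bottoms n W (W′ ∷ Ws) (g ∷ gs) (s≤s len) v∈ | inj₂ v∈rest with MemP.∈-map⁻ (map lower) v∈rest
...   | v′ , v′∈ , refl = lowered-bottom (s≤s len) (chain-bottoms n W′ Ws gs (ℕP.m≤n⇒m≤1+n len) v′∈)

-- The copies met by a chain are disjoint and each is traversed along a good word,
-- so the chained walk visits no vertex twice.
chain-distinct : ∀ n W Ws → All (GoodWord n) (W ∷ Ws) → length Ws ≤ suc (n + n) →
                 Unique (walk (identity (suc n)) (chain n W Ws))
chain-distinct n W [] (g ∷ _) _ rewrite good-walk-embed n W g = UniqueP.map⁺ embed-injective (GoodWord.distinct g)
chain-distinct n W (W′ ∷ Ws) (g ∷ gs) (s≤s len) rewrite chain-walk n W W′ Ws g =
  UniqueP.++⁺ (UniqueP.map⁺ embed-injective (GoodWord.distinct g))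
              (UniqueP.map⁺ (ListP.map-injective lower-injective) (chain-distinct n W′ Ws gs len′))
              disjoint
  where
  len′ = ℕP.m≤n⇒m≤1+n len
  disjoint : ∀ {v} → ¬ (v ∈ map embed (walk (identity n) W) × v ∈ map (map lower) (walk (identity (suc n)) (chain n W′ Ws)))
  disjoint (v∈first , v∈rest) with MemP.∈-map⁻ embed v∈first | MemP.∈-map⁻ (map lower) v∈rest
  ... | u , _ , v≡u | v′ , v′∈ , v≡v′ =
    embedded≢lowered u v′ (s≤s len) (chain-bottoms n W′ Ws gs len′ v′∈) (trans (sym v≡u) v≡v′)

record GoodPath (n m : ℕ) : Set where
  field
    word : List ℕ
    good : GoodWord n word
    size : suc (length word) ≡ m

chain-path : ∀ n W Ws → All (GoodWord n) (W ∷ Ws) → length Ws ≡ suc (n + n) →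
             GoodPath (suc n) (chainOrder (W ∷ Ws))
chain-path n W Ws gs len = record
  { word = chain n W Ws
  ; good = record
    { valid    = chain-valid n W Ws gs
    ; distinct = chain-distinct n W Ws gs (ℕP.≤-reflexive len)
    ; ends     = trans (chain-end n W Ws gs)
                       (trans (cong (iterate (map lower) (embed (flipped n))) len) (last-copy-end n))
    }
  ; size = trans (sym (length-walk (identity (suc n)) (chain n W Ws))) (length-chain-walk n W Ws)
  }

-- The single edge r_{n+1} is a good path of order 2; chaining it in allows fine
-- adjustments of the total order.
edge-path : ∀ n → GoodPath (suc n) 2
edge-path n = record
  { word = suc n ∷ []
  ; good = record { valid = (s≤s z≤n , ℕP.≤-refl) ∷ [] ; distinct = (identity≢flipped ∷ []) ∷ ([] ∷ []) ; ends = refl }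
  ; size = refl
  }
  where
  flipped-head : flipped (suc n) ≡ neg (largest n) ∷ turn (map embedEntry (identity n))
  flipped-head = trans (flipped-turn (suc n))
                       (trans (cong turn (identity-embed n)) (turn-∷ʳ (map embedEntry (identity n)) (largest n)))
  identity≢flipped : identity (suc n) ≢ flipped (suc n)
  identity≢flipped eq with cong proj₁ (ListP.∷-injectiveˡ (trans eq flipped-head))
  ... | ()

record RootedCycle (n ℓ : ℕ) : Set where
  field
    word          : List ℕ
    valid         : Indices n word
    closing       : ℕ
    closing-valid : 1 ≤ closing × closing ≤ n
    distinct      : Unique (walk (identity n) word)
    closes        : prefixRev closing (walkEnd (identity n) word) ≡ identity n
    size          : suc (length word) ≡ ℓ

path-cycle : ∀ {n m} → 1 ≤ n → GoodPath n m → RootedCycle n m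
path-cycle {n} 1≤n p = record
  { word          = word
  ; valid         = valid
  ; closing       = n
  ; closing-valid = 1≤n , ℕP.≤-refl
  ; distinct      = distinct
  ; closes        = trans (cong (prefixRev n) ends) (unflip n)
  ; size          = size
  }
  where
  open GoodPath p
  open GoodWord good

cycle-embed : ∀ {n ℓ} → RootedCycle n ℓ → RootedCycle (suc n) ℓ
cycle-embed {n} c = record
  { word          = word
  ; valid         = indices-weaken word valid
  ; closing       = closing
  ; closing-valid = proj₁ closing-valid , ℕP.m≤n⇒m≤1+n (proj₂ closing-valid)
  ; distinct      = subst Unique (sym walk≡) (UniqueP.map⁺ embed-injective distinct)
  ; closes        = closes′
  ; size          = size
  }
  where
  open RootedCycle c
  open ≡-Reasoning
  walk≡ : walk (identity (suc n)) word ≡ map embed (walk (identity n) word)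
  walk≡ = trans (cong (λ z → walk z word) (identity-embed n)) (walk-embed word (identity n) (length-identity n) valid)
  closing≤ : closing ≤ length (walkEnd (identity n) word)
  closing≤ = subst (closing ≤_) (sym (trans (length-walkEnd (identity n) word) (length-identity n))) (proj₂ closing-valid)
  closes′ : prefixRev closing (walkEnd (identity (suc n)) word) ≡ identity (suc n)
  closes′ = begin
    prefixRev closing (walkEnd (identity (suc n)) word) ≡⟨ cong (λ z → prefixRev closing (walkEnd z word)) (identity-embed n) ⟩
    prefixRev closing (walkEnd (embed (identity n)) word) ≡⟨ cong (prefixRev closing) (walkEnd-embed word (identity n) (length-identity n) valid) ⟩
    prefixRev closing (embed (walkEnd (identity n) word)) ≡⟨ prefixRev-embed closing (walkEnd (identity n) word) closing≤ ⟩
    embed (prefixRev closing (walkEnd (identity n) word)) ≡⟨ cong embed closes ⟩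
    embed (identity n)                                    ≡⟨ sym (identity-embed n) ⟩
    identity (suc n)                                      ∎

cycle-has : ∀ {n ℓ} → RootedCycle n ℓ → HasCycleOfLength n ℓ
cycle-has {n} c =
  identity n , steps (identity n) word ,
  trans (length-walk (identity n) word) size ,
  walk-signed (identity n) word (identity-signed n) ,
  distinct ,
  walk-linked (identity n) word (identity n) valid (closing , proj₁ closing-valid , proj₂ closing-valid , sym closes)
  where open RootedCycle c

chain-paths : ∀ n {m₀ ms} → GoodPath n m₀ → All (GoodPath n) ms → length ms ≡ suc (n + n) →
              GoodPath (suc n) (sum (m₀ ∷ ms))
chain-paths n p ps len =
  subst (GoodPath (suc n)) (cong₂ _+_ (GoodPath.size p) (chainOrder-words ps))
        (chain-path n (GoodPath.word p) (words ps) (GoodPath.good p ∷ words-good ps) (trans (length-words ps) len))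
  where
  words : ∀ {ms} → All (GoodPath n) ms → List (List ℕ)
  words []       = []
  words (q ∷ qs) = GoodPath.word q ∷ words qs
  words-good : ∀ {ms} (qs : All (GoodPath n) ms) → All (GoodWord n) (words qs)
  words-good []       = []
  words-good (q ∷ qs) = GoodPath.good q ∷ words-good qs
  length-words : ∀ {ms} (qs : All (GoodPath n) ms) → length (words qs) ≡ length ms
  length-words []       = refl
  length-words (q ∷ qs) = cong suc (length-words qs)
  chainOrder-words : ∀ {ms} (qs : All (GoodPath n) ms) → chainOrder (words qs) ≡ sum ms
  chainOrder-words []       = refl
  chainOrder-words (q ∷ qs) = cong₂ _+_ (GoodPath.size q) (chainOrder-words qs)

Admissible : ℕ → ℕ → ℕ → Set
Admissible A N m = m ≡ 2 ⊎ (A ≤ m × m ≤ N)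

module Decomposition (A N : ℕ) (A+A≤N : A + A ≤ N) (2≤N : 2 ≤ N) where

  A≤N : A ≤ N
  A≤N = ℕP.m+n≤o⇒m≤o A A+A≤N

  twice≤ : ∀ k → k + k ≤ k * N
  twice≤ k = subst (_≤ k * N) (double k) (ℕP.*-monoʳ-≤ k 2≤N)
    where
    double : ∀ k → k * 2 ≡ k + k
    double = solve-∀

  -- Split off one admissible part, leaving a total in range for one part fewer:
  -- the part is 2 if possible, otherwise as large as needed, otherwise A.
  split : ∀ k T → A + (suc k + suc k) ≤ T → T ≤ N + (N + k * N) →
          Σ ℕ λ s → Σ ℕ λ T′ → Admissible A N s × A + (k + k) ≤ T′ × T′ ≤ N + k * N × s + T′ ≡ T
  split k T lo hi with T ∸ 2 ℕ.≤? N + k * N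
  ... | yes rest≤ = 2 , T ∸ 2 , inj₁ refl , ℕP.m+n≤o⇒m≤o∸n _ lo′ , rest≤ , ℕP.m+[n∸m]≡n (ℕP.≤-trans (ℕP.m≤n+m 2 _) lo′)
    where
    plus-two : ∀ A k → A + (suc k + suc k) ≡ A + (k + k) + 2
    plus-two = solve-∀
    lo′ : A + (k + k) + 2 ≤ T
    lo′ = subst (_≤ T) (plus-two A k) lo
  ... | no rest≰ with A ℕ.≤? T ∸ (N + k * N)
  ...   | yes A≤ = T ∸ M , M , inj₂ (A≤ , ℕP.m≤n+o⇒m∸n≤o T M (subst (T ≤_) (ℕP.+-comm N M) hi)) ,
                   ℕP.+-mono-≤ A≤N (twice≤ k) , ℕP.≤-refl , ℕP.m∸n+n≡m M≤T
    where
    M = N + k * N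
    M≤T : M ≤ T
    M≤T = ℕP.≤-trans (ℕP.<⇒≤ (ℕP.≰⇒> rest≰)) (ℕP.m∸n≤m T 2)
  ...   | no A≰ = A , T ∸ A , inj₂ (ℕP.≤-refl , A≤N) , ℕP.m+n≤o⇒m≤o∸n _ lo′ , ℕP.m≤n+o⇒m∸n≤o T A T≤A+M ,
                  ℕP.m+[n∸m]≡n (ℕP.≤-trans (ℕP.m≤m+n A _) lo)
    where
    M = N + k * N
    M≤T : M ≤ T
    M≤T = ℕP.≤-trans (ℕP.<⇒≤ (ℕP.≰⇒> rest≰)) (ℕP.m∸n≤m T 2)
    T≤A+M : T ≤ A + M
    T≤A+M = subst (_≤ A + M) (ℕP.m∸n+n≡m M≤T) (ℕP.+-monoˡ-≤ M (ℕP.<⇒≤ (ℕP.≰⇒> A≰)))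
    reorder : ∀ A k → A + (k + k) + A ≡ (A + A) + (k + k)
    reorder = solve-∀
    lo′ : A + (k + k) + A ≤ T
    lo′ = subst (_≤ T) (sym (reorder A k)) (ℕP.≤-trans (ℕP.+-mono-≤ A+A≤N (twice≤ k)) M≤T)

  decompose : ∀ k T → A + (k + k) ≤ T → T ≤ N + k * N →
              Σ ℕ λ m → Σ (List ℕ) λ ms → All (Admissible A N) (m ∷ ms) × length ms ≡ k × sum (m ∷ ms) ≡ T
  decompose zero    T lo hi =
    T , [] , inj₂ (subst (_≤ T) (ℕP.+-identityʳ A) lo , subst (T ≤_) (ℕP.+-identityʳ N) hi) ∷ [] , refl , ℕP.+-identityʳ T
  decompose (suc k) T lo hi with split k T lo hi
  ... | s , T′ , s-ok , lo′ , hi′ , s+T′ with decompose k T′ lo′ hi′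
  ...   | m , ms , ok , len , total = s , m ∷ ms , s-ok ∷ ok , cong suc len , trans (cong (s +_) total) s+T′

-- N_n = |B_n| = 2^n n!, and K_n = 2n+1 bridges join the 2n+2 copies of BP_n in
-- BP_{n+1}, which exhaust it: N_{n+1} = N_n + K_n N_n.
groupOrder : ℕ → ℕ
groupOrder n = 2 ^ n * n !

bridges : ℕ → ℕ
bridges n = suc (n + n)

groupOrder-suc : ∀ n → groupOrder (suc n) ≡ groupOrder n + bridges n * groupOrder n
groupOrder-suc n = expand (2 ^ n) (n !) n
  where
  expand : ∀ x y n → (2 * x) * (suc n * y) ≡ x * y + suc (n + n) * (x * y)
  expand = solve-∀

record Invariant (n : ℕ) : Set where
  field
    threshold       : ℕ
    8≤threshold     : 8 ≤ threshold
    threshold-small : threshold + threshold ≤ groupOrder n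
    next-small      : threshold + (bridges n + bridges n) ≤ suc (groupOrder n)
    paths           : ∀ m → Admissible threshold (groupOrder n) m → GoodPath n m
    cycles          : ∀ ℓ → 8 ≤ ℓ → ℓ ≤ groupOrder n → RootedCycle n ℓ

bridge-cost : ∀ K N → 1 ≤ K → 8 ≤ N → 4 + ((K + K) + (K + K)) ≤ K * N
bridge-cost K N 1≤K 8≤N =
  ℕP.≤-trans (ℕP.+-monoˡ-≤ (4K) four≤) (subst (_≤ K * N) (eight K) (ℕP.*-monoʳ-≤ K 8≤N))
  where
  4K = (K + K) + (K + K)
  four≤ : 4 ≤ 4K
  four≤ = ℕP.+-mono-≤ (ℕP.+-mono-≤ 1≤K 1≤K) (ℕP.+-mono-≤ 1≤K 1≤K)
  eight : ∀ K → K * 8 ≡ ((K + K) + (K + K)) + ((K + K) + (K + K))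
  eight = solve-∀

next-bounds : ∀ n A → 8 ≤ A → A + A ≤ groupOrder n →
              (A + (bridges n + bridges n)) + (A + (bridges n + bridges n)) ≤ groupOrder (suc n) ×
              (A + (bridges n + bridges n)) + (bridges (suc n) + bridges (suc n)) ≤ suc (groupOrder (suc n))
next-bounds n A 8≤A A+A≤N rewrite groupOrder-suc n =
  subst (_≤ N + K * N) (sym (regroup A K)) (ℕP.+-mono-≤ A+A≤N (ℕP.≤-trans (ℕP.m≤n+m _ 4) cost)) ,
  subst (_≤ suc (N + K * N)) (sym (regroup′ A n)) (ℕP.m≤n⇒m≤1+n (ℕP.+-mono-≤ A≤N cost))
  where
  N = groupOrder n
  K = bridges n
  A≤N = ℕP.m+n≤o⇒m≤o A A+A≤N
  cost = bridge-cost K N (s≤s z≤n) (ℕP.≤-trans 8≤A A≤N)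
  regroup : ∀ A K → (A + (K + K)) + (A + (K + K)) ≡ (A + A) + ((K + K) + (K + K))
  regroup = solve-∀
  regroup′ : ∀ A n → (A + (suc (n + n) + suc (n + n))) + (suc (suc n + suc n) + suc (suc n + suc n))
                       ≡ A + (4 + ((suc (n + n) + suc (n + n)) + (suc (n + n) + suc (n + n))))
  regroup′ = solve-∀

invariant-step : ∀ n → Invariant n → Invariant (suc n)
invariant-step n inv = record
  { threshold       = A′
  ; 8≤threshold     = ℕP.≤-trans 8≤threshold (ℕP.m≤m+n threshold _)
  ; threshold-small = proj₁ (next-bounds n threshold 8≤threshold threshold-small)
  ; next-small      = proj₂ (next-bounds n threshold 8≤threshold threshold-small)
  ; paths           = paths′
  ; cycles          = cycles′
  }
  where
  open Invariant inv
  N = groupOrder n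
  A′ = threshold + (bridges n + bridges n)
  2≤N : 2 ≤ N
  2≤N = ℕP.≤-trans (s≤s (s≤s z≤n)) (ℕP.≤-trans 8≤threshold (ℕP.m+n≤o⇒m≤o threshold threshold-small))
  open Decomposition threshold N threshold-small 2≤N
  paths′ : ∀ m → Admissible A′ (groupOrder (suc n)) m → GoodPath (suc n) m
  paths′ m (inj₁ refl) = edge-path n
  paths′ m (inj₂ (lo , hi)) with decompose (bridges n) m lo (subst (m ≤_) (groupOrder-suc n) hi)
  ... | m₀ , ms , ok₀ ∷ ok , len , total =
    subst (GoodPath (suc n)) total (chain-paths n (paths m₀ ok₀) (All.map (paths _) ok) len)
  cycles′ : ∀ ℓ → 8 ≤ ℓ → ℓ ≤ groupOrder (suc n) → RootedCycle (suc n) ℓ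
  cycles′ ℓ 8≤ℓ ℓ≤ with ℓ ℕ.≤? N
  ... | yes ℓ≤N = cycle-embed (cycles ℓ 8≤ℓ ℓ≤N)
  ... | no ℓ≰N  = path-cycle (s≤s z≤n) (paths′ ℓ (inj₂ (ℕP.≤-trans next-small (ℕP.≰⇒> ℓ≰N) , ℓ≤)))

_≟ʷ_ : ∀ {n} → DecidableEquality (Window n)
_≟ʷ_ = ListP.≡-dec (ProdP.≡-dec BoolP._≟_ FinP._≟_)

good? : ∀ n W → Dec (GoodWord n W)
good? n W =
  Decidable.map′ (λ (v , d , e) → record { valid = v ; distinct = d ; ends = e })
           (λ g → GoodWord.valid g , GoodWord.distinct g , GoodWord.ends g)
           (All.all? (λ k → (1 ℕ.≤? k) ×-dec (k ℕ.≤? n)) W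
             ×-dec UniqueD.unique? _≟ʷ_ (walk (identity n) W)
             ×-dec walkEnd (identity n) W ≟ʷ flipped n)

-- Good words of BP_3 of orders 8, 9, …, 48 = N_3, found by computer search.
bp3-words : List (List ℕ)
bp3-words =
  (2 ∷ 3 ∷ 1 ∷ 3 ∷ 2 ∷ 3 ∷ 1 ∷ []) ∷
  (1 ∷ 2 ∷ 1 ∷ 3 ∷ 2 ∷ 3 ∷ 2 ∷ 1 ∷ []) ∷
  (1 ∷ 2 ∷ 3 ∷ 1 ∷ 3 ∷ 2 ∷ 1 ∷ 3 ∷ 1 ∷ []) ∷
  (1 ∷ 3 ∷ 2 ∷ 3 ∷ 2 ∷ 3 ∷ 1 ∷ 2 ∷ 3 ∷ 1 ∷ []) ∷
  (1 ∷ 3 ∷ 1 ∷ 2 ∷ 3 ∷ 1 ∷ 2 ∷ 1 ∷ 2 ∷ 3 ∷ 2 ∷ []) ∷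
  (1 ∷ 2 ∷ 1 ∷ 3 ∷ 2 ∷ 3 ∷ 1 ∷ 2 ∷ 1 ∷ 2 ∷ 1 ∷ 2 ∷ []) ∷
  (1 ∷ 3 ∷ 2 ∷ 3 ∷ 2 ∷ 1 ∷ 2 ∷ 3 ∷ 2 ∷ 3 ∷ 1 ∷ 3 ∷ 1 ∷ []) ∷
  (2 ∷ 1 ∷ 3 ∷ 1 ∷ 3 ∷ 2 ∷ 1 ∷ 2 ∷ 3 ∷ 1 ∷ 2 ∷ 3 ∷ 2 ∷ 1 ∷ []) ∷
  (1 ∷ 3 ∷ 1 ∷ 3 ∷ 1 ∷ 2 ∷ 3 ∷ 1 ∷ 3 ∷ 1 ∷ 2 ∷ 3 ∷ 2 ∷ 1 ∷ 2 ∷ []) ∷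
  (2 ∷ 3 ∷ 1 ∷ 2 ∷ 1 ∷ 2 ∷ 1 ∷ 2 ∷ 3 ∷ 1 ∷ 3 ∷ 2 ∷ 1 ∷ 2 ∷ 3 ∷ 2 ∷ []) ∷
  (1 ∷ 3 ∷ 2 ∷ 1 ∷ 3 ∷ 2 ∷ 3 ∷ 2 ∷ 1 ∷ 2 ∷ 3 ∷ 1 ∷ 2 ∷ 3 ∷ 1 ∷ 2 ∷ 1 ∷ []) ∷
  (1 ∷ 3 ∷ 2 ∷ 3 ∷ 1 ∷ 2 ∷ 3 ∷ 1 ∷ 2 ∷ 1 ∷ 2 ∷ 1 ∷ 2 ∷ 3 ∷ 2 ∷ 1 ∷ 2 ∷ 1 ∷ []) ∷
  (2 ∷ 3 ∷ 1 ∷ 3 ∷ 1 ∷ 2 ∷ 1 ∷ 2 ∷ 3 ∷ 2 ∷ 1 ∷ 2 ∷ 1 ∷ 3 ∷ 2 ∷ 3 ∷ 2 ∷ 1 ∷ 2 ∷ []) ∷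
  (1 ∷ 2 ∷ 1 ∷ 3 ∷ 2 ∷ 3 ∷ 1 ∷ 3 ∷ 2 ∷ 1 ∷ 2 ∷ 3 ∷ 2 ∷ 1 ∷ 3 ∷ 2 ∷ 1 ∷ 2 ∷ 3 ∷ 1 ∷ []) ∷
  (2 ∷ 1 ∷ 2 ∷ 3 ∷ 1 ∷ 2 ∷ 1 ∷ 2 ∷ 3 ∷ 1 ∷ 2 ∷ 1 ∷ 2 ∷ 3 ∷ 1 ∷ 2 ∷ 3 ∷ 1 ∷ 3 ∷ 1 ∷ 2 ∷ []) ∷
  (2 ∷ 3 ∷ 1 ∷ 2 ∷ 1 ∷ 2 ∷ 1 ∷ 3 ∷ 2 ∷ 3 ∷ 2 ∷ 3 ∷ 1 ∷ 2 ∷ 1 ∷ 3 ∷ 2 ∷ 1 ∷ 3 ∷ 2 ∷ 1 ∷ 2 ∷ []) ∷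
  (1 ∷ 3 ∷ 2 ∷ 1 ∷ 3 ∷ 1 ∷ 3 ∷ 2 ∷ 3 ∷ 2 ∷ 1 ∷ 3 ∷ 2 ∷ 1 ∷ 3 ∷ 2 ∷ 3 ∷ 2 ∷ 3 ∷ 2 ∷ 1 ∷ 3 ∷ 2 ∷ []) ∷
  (2 ∷ 1 ∷ 3 ∷ 1 ∷ 2 ∷ 3 ∷ 1 ∷ 2 ∷ 1 ∷ 3 ∷ 2 ∷ 1 ∷ 3 ∷ 2 ∷ 1 ∷ 2 ∷ 3 ∷ 1 ∷ 2 ∷ 3 ∷ 2 ∷ 1 ∷ 2 ∷ 1 ∷ []) ∷
  (1 ∷ 3 ∷ 1 ∷ 2 ∷ 3 ∷ 2 ∷ 1 ∷ 2 ∷ 3 ∷ 1 ∷ 3 ∷ 1 ∷ 2 ∷ 1 ∷ 2 ∷ 3 ∷ 2 ∷ 3 ∷ 1 ∷ 2 ∷ 1 ∷ 2 ∷ 1 ∷ 3 ∷ 1 ∷ []) ∷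
  (1 ∷ 3 ∷ 2 ∷ 1 ∷ 2 ∷ 3 ∷ 2 ∷ 3 ∷ 1 ∷ 2 ∷ 1 ∷ 2 ∷ 1 ∷ 2 ∷ 3 ∷ 2 ∷ 3 ∷ 1 ∷ 2 ∷ 1 ∷ 2 ∷ 3 ∷ 1 ∷ 2 ∷ 1 ∷ 2 ∷ []) ∷
  (2 ∷ 3 ∷ 2 ∷ 1 ∷ 3 ∷ 1 ∷ 2 ∷ 3 ∷ 1 ∷ 3 ∷ 2 ∷ 3 ∷ 2 ∷ 1 ∷ 2 ∷ 1 ∷ 2 ∷ 1 ∷ 3 ∷ 2 ∷ 3 ∷ 2 ∷ 3 ∷ 1 ∷ 3 ∷ 1 ∷ 2 ∷ []) ∷
  (2 ∷ 1 ∷ 2 ∷ 1 ∷ 2 ∷ 1 ∷ 3 ∷ 1 ∷ 2 ∷ 3 ∷ 2 ∷ 1 ∷ 3 ∷ 2 ∷ 3 ∷ 2 ∷ 3 ∷ 2 ∷ 1 ∷ 2 ∷ 1 ∷ 3 ∷ 2 ∷ 1 ∷ 3 ∷ 2 ∷ 3 ∷ 1 ∷ []) ∷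
  (2 ∷ 1 ∷ 2 ∷ 1 ∷ 3 ∷ 1 ∷ 2 ∷ 1 ∷ 3 ∷ 2 ∷ 1 ∷ 2 ∷ 3 ∷ 1 ∷ 3 ∷ 2 ∷ 3 ∷ 2 ∷ 1 ∷ 3 ∷ 1 ∷ 3 ∷ 2 ∷ 1 ∷ 3 ∷ 2 ∷ 3 ∷ 2 ∷ 1 ∷ []) ∷
  (2 ∷ 1 ∷ 2 ∷ 3 ∷ 2 ∷ 3 ∷ 2 ∷ 1 ∷ 2 ∷ 3 ∷ 1 ∷ 3 ∷ 2 ∷ 3 ∷ 2 ∷ 3 ∷ 1 ∷ 2 ∷ 1 ∷ 3 ∷ 2 ∷ 1 ∷ 2 ∷ 3 ∷ 2 ∷ 1 ∷ 3 ∷ 1 ∷ 3 ∷ 1 ∷ []) ∷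
  (2 ∷ 3 ∷ 2 ∷ 1 ∷ 3 ∷ 1 ∷ 2 ∷ 3 ∷ 1 ∷ 3 ∷ 1 ∷ 3 ∷ 2 ∷ 3 ∷ 1 ∷ 3 ∷ 1 ∷ 3 ∷ 2 ∷ 1 ∷ 3 ∷ 1 ∷ 2 ∷ 1 ∷ 3 ∷ 1 ∷ 3 ∷ 1 ∷ 2 ∷ 1 ∷ 2 ∷ []) ∷
  (2 ∷ 3 ∷ 2 ∷ 1 ∷ 3 ∷ 2 ∷ 3 ∷ 2 ∷ 1 ∷ 2 ∷ 1 ∷ 3 ∷ 2 ∷ 3 ∷ 2 ∷ 1 ∷ 2 ∷ 3 ∷ 1 ∷ 2 ∷ 3 ∷ 1 ∷ 3 ∷ 2 ∷ 3 ∷ 2 ∷ 3 ∷ 1 ∷ 3 ∷ 2 ∷ 3 ∷ 2 ∷ []) ∷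
  (1 ∷ 3 ∷ 1 ∷ 2 ∷ 1 ∷ 3 ∷ 2 ∷ 1 ∷ 3 ∷ 1 ∷ 2 ∷ 1 ∷ 2 ∷ 3 ∷ 1 ∷ 3 ∷ 2 ∷ 1 ∷ 3 ∷ 2 ∷ 1 ∷ 3 ∷ 1 ∷ 3 ∷ 1 ∷ 3 ∷ 1 ∷ 2 ∷ 3 ∷ 2 ∷ 1 ∷ 3 ∷ 1 ∷ []) ∷
  (1 ∷ 3 ∷ 1 ∷ 3 ∷ 1 ∷ 3 ∷ 2 ∷ 1 ∷ 2 ∷ 3 ∷ 1 ∷ 3 ∷ 2 ∷ 1 ∷ 3 ∷ 1 ∷ 2 ∷ 1 ∷ 3 ∷ 1 ∷ 3 ∷ 2 ∷ 1 ∷ 2 ∷ 3 ∷ 1 ∷ 3 ∷ 1 ∷ 3 ∷ 2 ∷ 3 ∷ 2 ∷ 1 ∷ 2 ∷ []) ∷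
  (2 ∷ 3 ∷ 1 ∷ 2 ∷ 1 ∷ 3 ∷ 1 ∷ 3 ∷ 1 ∷ 3 ∷ 1 ∷ 2 ∷ 1 ∷ 3 ∷ 1 ∷ 2 ∷ 3 ∷ 1 ∷ 3 ∷ 2 ∷ 1 ∷ 2 ∷ 1 ∷ 2 ∷ 3 ∷ 1 ∷ 3 ∷ 2 ∷ 1 ∷ 3 ∷ 1 ∷ 2 ∷ 3 ∷ 2 ∷ 1 ∷ []) ∷
  (1 ∷ 2 ∷ 3 ∷ 2 ∷ 1 ∷ 2 ∷ 3 ∷ 1 ∷ 2 ∷ 1 ∷ 3 ∷ 1 ∷ 2 ∷ 1 ∷ 2 ∷ 1 ∷ 2 ∷ 1 ∷ 3 ∷ 2 ∷ 3 ∷ 2 ∷ 1 ∷ 2 ∷ 3 ∷ 2 ∷ 3 ∷ 2 ∷ 1 ∷ 3 ∷ 1 ∷ 2 ∷ 3 ∷ 2 ∷ 3 ∷ 2 ∷ []) ∷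
  (2 ∷ 1 ∷ 3 ∷ 2 ∷ 1 ∷ 3 ∷ 2 ∷ 3 ∷ 1 ∷ 2 ∷ 3 ∷ 1 ∷ 2 ∷ 1 ∷ 3 ∷ 1 ∷ 2 ∷ 1 ∷ 2 ∷ 3 ∷ 1 ∷ 2 ∷ 1 ∷ 3 ∷ 2 ∷ 3 ∷ 1 ∷ 3 ∷ 1 ∷ 2 ∷ 1 ∷ 3 ∷ 2 ∷ 1 ∷ 3 ∷ 1 ∷ 2 ∷ []) ∷
  (1 ∷ 2 ∷ 1 ∷ 2 ∷ 3 ∷ 2 ∷ 1 ∷ 3 ∷ 1 ∷ 3 ∷ 1 ∷ 2 ∷ 1 ∷ 3 ∷ 2 ∷ 1 ∷ 3 ∷ 1 ∷ 2 ∷ 3 ∷ 2 ∷ 3 ∷ 2 ∷ 3 ∷ 1 ∷ 2 ∷ 1 ∷ 3 ∷ 2 ∷ 3 ∷ 2 ∷ 3 ∷ 1 ∷ 2 ∷ 3 ∷ 1 ∷ 2 ∷ 1 ∷ []) ∷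
  (1 ∷ 3 ∷ 1 ∷ 2 ∷ 3 ∷ 1 ∷ 3 ∷ 2 ∷ 3 ∷ 1 ∷ 2 ∷ 1 ∷ 3 ∷ 2 ∷ 1 ∷ 3 ∷ 1 ∷ 2 ∷ 1 ∷ 2 ∷ 3 ∷ 1 ∷ 2 ∷ 3 ∷ 1 ∷ 2 ∷ 1 ∷ 2 ∷ 1 ∷ 3 ∷ 1 ∷ 3 ∷ 1 ∷ 2 ∷ 3 ∷ 1 ∷ 2 ∷ 1 ∷ 2 ∷ []) ∷
  (1 ∷ 2 ∷ 1 ∷ 2 ∷ 3 ∷ 2 ∷ 3 ∷ 1 ∷ 3 ∷ 2 ∷ 3 ∷ 2 ∷ 1 ∷ 3 ∷ 2 ∷ 3 ∷ 2 ∷ 3 ∷ 2 ∷ 3 ∷ 1 ∷ 2 ∷ 1 ∷ 2 ∷ 1 ∷ 3 ∷ 2 ∷ 3 ∷ 2 ∷ 1 ∷ 2 ∷ 3 ∷ 1 ∷ 3 ∷ 1 ∷ 2 ∷ 3 ∷ 1 ∷ 3 ∷ 2 ∷ []) ∷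
  (1 ∷ 2 ∷ 1 ∷ 3 ∷ 2 ∷ 3 ∷ 2 ∷ 3 ∷ 1 ∷ 2 ∷ 3 ∷ 2 ∷ 3 ∷ 2 ∷ 3 ∷ 1 ∷ 3 ∷ 2 ∷ 3 ∷ 2 ∷ 1 ∷ 2 ∷ 1 ∷ 3 ∷ 2 ∷ 3 ∷ 2 ∷ 3 ∷ 2 ∷ 3 ∷ 2 ∷ 1 ∷ 2 ∷ 1 ∷ 2 ∷ 3 ∷ 2 ∷ 3 ∷ 2 ∷ 3 ∷ 2 ∷ []) ∷
  (2 ∷ 1 ∷ 2 ∷ 3 ∷ 2 ∷ 1 ∷ 3 ∷ 2 ∷ 3 ∷ 2 ∷ 1 ∷ 3 ∷ 2 ∷ 1 ∷ 3 ∷ 2 ∷ 3 ∷ 1 ∷ 2 ∷ 3 ∷ 2 ∷ 1 ∷ 2 ∷ 1 ∷ 2 ∷ 1 ∷ 3 ∷ 2 ∷ 1 ∷ 3 ∷ 1 ∷ 3 ∷ 1 ∷ 2 ∷ 1 ∷ 2 ∷ 1 ∷ 3 ∷ 2 ∷ 1 ∷ 3 ∷ 1 ∷ []) ∷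
  (2 ∷ 1 ∷ 2 ∷ 1 ∷ 2 ∷ 1 ∷ 3 ∷ 2 ∷ 1 ∷ 3 ∷ 1 ∷ 2 ∷ 1 ∷ 2 ∷ 1 ∷ 2 ∷ 1 ∷ 3 ∷ 1 ∷ 2 ∷ 1 ∷ 3 ∷ 2 ∷ 1 ∷ 2 ∷ 3 ∷ 1 ∷ 3 ∷ 1 ∷ 2 ∷ 1 ∷ 2 ∷ 1 ∷ 2 ∷ 1 ∷ 3 ∷ 1 ∷ 2 ∷ 1 ∷ 2 ∷ 1 ∷ 2 ∷ 1 ∷ []) ∷
  (2 ∷ 1 ∷ 3 ∷ 1 ∷ 3 ∷ 2 ∷ 3 ∷ 1 ∷ 3 ∷ 1 ∷ 2 ∷ 1 ∷ 2 ∷ 3 ∷ 2 ∷ 1 ∷ 3 ∷ 1 ∷ 2 ∷ 1 ∷ 2 ∷ 3 ∷ 1 ∷ 2 ∷ 3 ∷ 2 ∷ 3 ∷ 1 ∷ 2 ∷ 3 ∷ 2 ∷ 3 ∷ 2 ∷ 1 ∷ 2 ∷ 3 ∷ 2 ∷ 3 ∷ 1 ∷ 2 ∷ 1 ∷ 2 ∷ 3 ∷ 2 ∷ []) ∷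
  (1 ∷ 3 ∷ 2 ∷ 3 ∷ 2 ∷ 1 ∷ 3 ∷ 1 ∷ 3 ∷ 1 ∷ 2 ∷ 3 ∷ 2 ∷ 1 ∷ 3 ∷ 1 ∷ 2 ∷ 1 ∷ 2 ∷ 1 ∷ 2 ∷ 3 ∷ 2 ∷ 3 ∷ 1 ∷ 3 ∷ 2 ∷ 1 ∷ 2 ∷ 1 ∷ 3 ∷ 1 ∷ 3 ∷ 1 ∷ 2 ∷ 3 ∷ 1 ∷ 2 ∷ 1 ∷ 3 ∷ 1 ∷ 2 ∷ 1 ∷ 2 ∷ 1 ∷ []) ∷
  (1 ∷ 3 ∷ 1 ∷ 2 ∷ 1 ∷ 3 ∷ 2 ∷ 3 ∷ 1 ∷ 2 ∷ 1 ∷ 2 ∷ 3 ∷ 1 ∷ 2 ∷ 3 ∷ 1 ∷ 2 ∷ 1 ∷ 3 ∷ 2 ∷ 1 ∷ 3 ∷ 2 ∷ 1 ∷ 2 ∷ 1 ∷ 2 ∷ 3 ∷ 1 ∷ 3 ∷ 1 ∷ 2 ∷ 1 ∷ 2 ∷ 3 ∷ 1 ∷ 2 ∷ 1 ∷ 3 ∷ 2 ∷ 1 ∷ 2 ∷ 1 ∷ 3 ∷ 1 ∷ []) ∷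
  (1 ∷ 3 ∷ 1 ∷ 2 ∷ 1 ∷ 3 ∷ 1 ∷ 3 ∷ 1 ∷ 3 ∷ 1 ∷ 2 ∷ 1 ∷ 2 ∷ 3 ∷ 1 ∷ 3 ∷ 1 ∷ 2 ∷ 1 ∷ 3 ∷ 1 ∷ 3 ∷ 1 ∷ 2 ∷ 3 ∷ 1 ∷ 2 ∷ 1 ∷ 3 ∷ 2 ∷ 1 ∷ 3 ∷ 1 ∷ 3 ∷ 1 ∷ 2 ∷ 1 ∷ 3 ∷ 1 ∷ 3 ∷ 2 ∷ 1 ∷ 2 ∷ 1 ∷ 3 ∷ 1 ∷ []) ∷
  []

bp3-word : ℕ → List ℕ
bp3-word i = fromMaybe [] (head (drop i bp3-words))

bp3-correct : All (λ i → GoodWord 3 (bp3-word i) × suc (length (bp3-word i)) ≡ 8 + i) (upTo 41)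
bp3-correct =
  toWitness {a? = All.all? (λ i → good? 3 (bp3-word i) ×-dec (suc (length (bp3-word i)) ℕ.≟ 8 + i)) (upTo 41)} tt

bp3-path : ∀ m → 8 ≤ m → m ≤ 48 → GoodPath 3 m
bp3-path m 8≤m m≤48 = record
  { word = bp3-word (m ∸ 8)
  ; good = proj₁ checked
  ; size = trans (proj₂ checked) (ℕP.m+[n∸m]≡n 8≤m)
  }
  where
  checked = All.lookup bp3-correct (MemP.∈-upTo⁺ (s≤s (ℕP.∸-monoˡ-≤ 8 m≤48)))

invariant-three : Invariant 3
invariant-three = record
  { threshold       = 8
  ; 8≤threshold     = ℕP.≤-refl
  ; threshold-small = ℕP.≤ᵇ⇒≤ 16 48 tt
  ; next-small      = ℕP.≤ᵇ⇒≤ 22 49 tt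
  ; paths           = paths
  ; cycles          = λ ℓ 8≤ℓ ℓ≤48 → path-cycle (s≤s z≤n) (bp3-path ℓ 8≤ℓ ℓ≤48)
  }
  where
  paths : ∀ m → Admissible 8 48 m → GoodPath 3 m
  paths m (inj₁ refl)       = edge-path 2
  paths m (inj₂ (lo , hi)) = bp3-path m lo hi

invariant : ∀ j → Invariant (3 + j)
invariant zero    = invariant-three
invariant (suc j) = invariant-step (3 + j) (invariant j)

octagon : RootedCycle 2 8
octagon = record
  { word          = word
  ; valid         = toWitness {a? = All.all? (λ k → (1 ℕ.≤? k) ×-dec (k ℕ.≤? 2)) word} tt
  ; closing       = 2
  ; closing-valid = s≤s z≤n , ℕP.≤-refl
  ; distinct      = toWitness {a? = UniqueD.unique? _≟ʷ_ (walk (identity 2) word)} tt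
  ; closes        = refl
  ; size          = refl
  }
  where
  word : List ℕ
  word = 1 ∷ 2 ∷ 1 ∷ 2 ∷ 1 ∷ 2 ∷ 1 ∷ []

theorem3p14 : (n ℓ : ℕ) → 2 ≤ n → 8 ≤ ℓ → ℓ ≤ 2 ^ n * n ! → HasCycleOfLength n ℓ
theorem3p14 zero                ℓ ()        _   _
theorem3p14 (suc zero)          ℓ (s≤s ())  _   _
theorem3p14 (suc (suc zero))    ℓ _         8≤ℓ ℓ≤8 with ℕP.≤-antisym 8≤ℓ ℓ≤8
... | refl = cycle-has octagon
theorem3p14 (suc (suc (suc j))) ℓ _         8≤ℓ ℓ≤N = cycle-has (Invariant.cycles (invariant j) ℓ 8≤ℓ ℓ≤N)
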